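{- Let $b\in\mathbb{N}$ and $\tau\in\{\tau^b_0,\tau^b_1,\tau^b_2,\tau^b_3\}$, where $b\geq 1$ if $\tau\in\{\tau^b_0,\tau^b_1\}$ and $b\geq 2$ if $\tau\in\{\tau^b_2,\tau^b_3\}$. Let $U=U(A_0,\dots,A_n)$ be a union of initialized transition systems with pairwise disjoint state sets such that for every event $e\in E_U$ there is a state $s\in S_U$ at which $e$ does not occur. Then $U$ has the $\tau$-ESSP if and only if the joining $A(U)$ has the $\tau$-ESSP, and $U$ has the $\tau$-SSP if and only if $A(U)$ has the $\tau$-SSP.
   Context: A transition system (TS) $A=(S_A,E_A,\delta_A,s_{0,A})$ (initialized) has finite disjoint sets of states and events, a partial transition function $\delta_A:S_A\times E_A\to S_A$ (write $s\xrightarrow{e}s'$), and an initial state from which every state is reachable. Types of nets for $b\in\mathbb{N}$: $\tau^b_0=(\{0,\dots,b\},\{0,\dots,b\}^2,\delta)$ with $\delta(s,(m,n))=s-m+n$ if $s\geq m$ and $s-m+n\leq b$, undefined otherwise; $\tau^b_1$ is $\tau^b_0$ with the events $\{(m,n)\mid 1\leq m,n\leq b\}$ removed; $\tau^b_2$ has states $\{0,\dots,b\}$, events $(\{0,\dots,b\}^2\setminus\{(0,0)\})\cup\{0,\dots,b\}$ (group elements distinct from pairs), pairs acting as in $\tau^b_0$ and a group element $e$ acting by $s\mapsto (s+e)\bmod(b+1)$; $\tau^b_3$ is $\tau^b_2$ with the events $\{(m,n)\mid 1\leq m,n\leq b\}$ removed. A $\tau$-region of a TS $A$ is $(sup,sig)$,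 $sup:S_A\to S_\tau$, $sig:E_A\to E_\tau$, such that each transition $s\xrightarrow{e}s'$ of $A$ gives a transition $sup(s)\xrightarrow{sig(e)}sup(s')$ of $\tau$. A TS $A$ has the $\tau$-SSP if for all distinct $s,s'\in S_A$ some $\tau$-region has $sup(s)\neq sup(s')$, and the $\tau$-ESSP if for every event $e$ and state $s$ at which $e$ does not occur some $\tau$-region has $sig(e)$ not occurring at $sup(s)$ in $\tau$. Union: for TSs $A_0,\dots,A_n$ with pairwise disjoint state sets (events may be shared), $U=U(A_0,\dots,A_n)$ has $S_U=\bigcup_i S_{A_i}$, $E_U=\bigcup_i E_{A_i}$. A $\tau$-region of $U$ is $(sup,sig)$ with $sup:S_U\to S_\tau$, $sig:E_U\to E_\tau$ whose restriction to each $A_i$ is a $\tau$-region of $A_i$. $U$ has the $\tau$-SSP if for all distinct states $s,s'$ of the same $A_i$ some $\tau$-region of $U$ has $sup(s)\neq sup(s')$; $U$ has the $\tau$-ESSP if for all $e\in E_U$ and $s\in S_U$ such that $e$ does not occur at $s$ (in the TS containing $s$), some $\tau$-region of $U$ has $sig(e)$ not occurring at $sup(s)$. Joining: $A(U)=(S_U\cup Q,\ E_U\cup W\cup Y,\ \delta,\ q_0)$ with fresh states $Q=\{q_0,\dots,q_n\}$ and fresh events $W=\{w_1,\dots,w_n\}$, $Y=\{y_0,\dots,y_n\}$, where $\delta(q_i,y_i)=s_{0,A_i}$ for $0\leq i\leq n$, $\delta(q_i,w_{i+1})=q_{i+1}$ for $0\leq i\leq n-1$, $\delta(s,e)=\delta_{A_i}(s,e)$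 for $s\in S_{A_i}$, $e\in E_{A_i}$, and undefined otherwise. -}

module Defs where

open import Data.Nat using (ℕ; zero; suc; _+_; _∸_; _≤_; _%_)
open import Data.Fin using (Fin; toℕ; inject₁; _≟_)
import Data.Fin as F
open import Data.Maybe using (Maybe; just; nothing)
import Data.Maybe as M
open import Data.Product using (Σ; Σ-syntax; _×_; _,_; proj₁; proj₂)
open import Data.Sum using (_⊎_; inj₁; inj₂)
open import Data.Unit using (⊤)
open import Data.Empty using (⊥)
open import Relation.Nullary using (¬_; does)
open import Relation.Binary.PropositionalEquality using (_≡_; _≢_)
open import Data.Bool using (if_then_else_)

data Reachable {S E : Set} (δ : S → E → Maybe S) (s₀ : S) : S → Set where
  base : Reachable δ s₀ s₀
  step : ∀ {s e s'} → Reachable δ s₀ s → δ s e ≡ just s' → Reachable δ s₀ s'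

data NetType : Set where
  τ0 τ1 τ2 τ3 : NetType

-- raw events: pairs (m,n) and group elements of Z_{b+1}
data Ev (b : ℕ) : Set where
  pair : Fin (suc b) → Fin (suc b) → Ev b
  grp  : Fin (suc b) → Ev b

Allowed : NetType → (b : ℕ) → Ev b → Set
Allowed τ0 b (pair m n) = ⊤
Allowed τ0 b (grp g)    = ⊥
Allowed τ1 b (pair m n) = (m ≡ F.zero) ⊎ (n ≡ F.zero)
Allowed τ1 b (grp g)    = ⊥
Allowed τ2 b (pair m n) = ¬ ((m ≡ F.zero) × (n ≡ F.zero))
Allowed τ2 b (grp g)    = ⊤
Allowed τ3 b (pair m n) = ((m ≡ F.zero) ⊎ (n ≡ F.zero)) × ¬ ((m ≡ F.zero) × (n ≡ F.zero))
Allowed τ3 b (grp g)    = ⊤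

TEv : NetType → ℕ → Set
TEv t b = Σ (Ev b) (Allowed t b)

-- transitions of τ (the same rule for all four types, on allowed events):
-- (m,n) : s ↦ s - m + n   if s ≥ m and s - m + n ≤ b (the bound is
--                         enforced by the target living in Fin (suc b))
-- g     : s ↦ (s + g) mod (b+1)
Step : (b : ℕ) → Fin (suc b) → Ev b → Fin (suc b) → Set
Step b s (pair m n) s' = (toℕ m ≤ toℕ s) × (toℕ s' ≡ (toℕ s ∸ toℕ m) + toℕ n)
Step b s (grp g)    s' = toℕ s' ≡ (toℕ s + toℕ g) % suc b

OccursT : (b : ℕ) → Fin (suc b) → Ev b → Set
OccursT b x ev = Σ[ y ∈ Fin (suc b) ] Step b x ev y

Admissible : NetType → ℕ → Set
Admissible τ0 b = 1 ≤ b
Admissible τ1 b = 1 ≤ b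
Admissible τ2 b = 2 ≤ b
Admissible τ3 b = 2 ≤ b

record Region (t : NetType) (b : ℕ) {S E : Set} (δ : S → E → Maybe S) : Set where
  field
    sup   : S → Fin (suc b)
    sig   : E → TEv t b
    valid : ∀ s e s' → δ s e ≡ just s' → Step b (sup s) (proj₁ (sig e)) (sup s')
open Region public

SSP : NetType → ℕ → {S E : Set} → (S → E → Maybe S) → Set
SSP t b {S} δ = ∀ (s s' : S) → s ≢ s' →
  Σ[ R ∈ Region t b δ ] sup R s ≢ sup R s'

ESSP : NetType → ℕ → {S E : Set} → (S → E → Maybe S) → Set
ESSP t b {S} {E} δ = ∀ (e : E) (s : S) → δ s e ≡ nothing →
  Σ[ R ∈ Region t b δ ] ¬ OccursT b (sup R s) (proj₁ (sig R e))

-- Initialized transition systems with finite state set, over a common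
-- finite event set Fin m (the events of the union E_U)

record TS (m : ℕ) : Set where
  field
    size  : ℕ
    δ     : Fin size → Fin m → Maybe (Fin size)
    s₀    : Fin size
    reach : ∀ s → Reachable δ s₀ s
open TS public

-- Unions U(A_0,…,A_n); states are tagged by their component, so the
-- state sets are pairwise disjoint by construction.

module _ {n m : ℕ} (A : Fin (suc n) → TS m) where

  SU : Set
  SU = Σ[ i ∈ Fin (suc n) ] Fin (size (A i))

  NotOccU : Fin m → SU → Set
  NotOccU e (i , s) = δ (A i) s e ≡ nothing

  record URegion (t : NetType) (b : ℕ) : Set where
    field
      usup   : SU → Fin (suc b)
      usig   : Fin m → TEv t b
      uvalid : ∀ i s e s' → δ (A i) s e ≡ just s' →
               Step b (usup (i , s)) (proj₁ (usig e)) (usup (i , s'))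
  open URegion public

  USSP : NetType → ℕ → Set
  USSP t b = ∀ i (s s' : Fin (size (A i))) → s ≢ s' →
    Σ[ R ∈ URegion t b ] usup R (i , s) ≢ usup R (i , s')

  UESSP : NetType → ℕ → Set
  UESSP t b = ∀ (e : Fin m) (x : SU) → NotOccU e x →
    Σ[ R ∈ URegion t b ] ¬ OccursT b (usup R x) (proj₁ (usig R e))

  -- Joining A(U): states S_U ∪ Q with Q = {q_0,…,q_n} ≅ Fin (suc n);
  -- events E_U ∪ W ∪ Y with W = {w_1,…,w_n} (w_{j+1} ↔ j : Fin n) and
  -- Y = {y_0,…,y_n} ≅ Fin (suc n).

  JS : Set
  JS = SU ⊎ Fin (suc n)

  JE : Set
  JE = Fin m ⊎ (Fin n ⊎ Fin (suc n))

  Jδ : JS → JE → Maybe JS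
  Jδ (inj₁ (i , s)) (inj₁ e) = M.map (λ s' → inj₁ (i , s')) (δ (A i) s e)
  Jδ (inj₁ _) (inj₂ _) = nothing
  Jδ (inj₂ q) (inj₁ e) = nothing
  Jδ (inj₂ q) (inj₂ (inj₁ j)) =
    if does (q ≟ inject₁ j) then just (inj₂ (F.suc j)) else nothing
  Jδ (inj₂ q) (inj₂ (inj₂ y)) =
    if does (q ≟ y) then just (inj₁ (q , s₀ (A q))) else nothing

  Jq₀ : JS
  Jq₀ = inj₂ F.zero

module Submission where

-- A τ-region of the joining A(U) restricts to a τ-region of
-- the union U, so the ESSP/SSP of A(U) gives those of U at once.  For the
-- converse, any region of U extends to a region of A(U) once the support
-- on the fresh states Q = {q₀,…,qₙ} is chosen freely: every type of nets
-- has, for all states x and y, an event moving x to y (`move` below), which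
-- serves as the signature of the connecting events wᵢ and yᵢ.  The
-- separation problems of A(U) not already solved by U are then solved by
-- extensions of "flat" regions of U (constant on each component, identity
-- signatures) with a spike at one state qₖ: the connecting event leaving qₖ
-- gets the signature move(b, 0), which does not occur at state 0.  Here
-- b ≥ 1 is used; the hypothesis that every event of U is blocked somewhere
-- in U handles events of U at the states of Q.

open import Defs
open import Data.Nat using (ℕ; suc; _∸_; _+_; _%_; _≤_; _<_; z≤n; s≤s)
open import Data.Nat.Properties
  using (≤-total; ≤-trans; ≤-antisym; ≤-<-trans; m∸n≤m; m≤n⇒m∸n≡0; m∸n≡0⇒m≤n;
         m+[n∸m]≡n; m∸[m∸n]≡n; +-identityʳ; n∸n≡0; <⇒≱; n≮0; <-irrefl)
open import Data.Nat.DivMod using (m<n⇒m%n≡m)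
import Data.Fin as F
open import Data.Fin using (Fin; toℕ; inject₁; fromℕ; fromℕ<; _≟_)
open import Data.Fin.Properties
  using (toℕ-injective; toℕ<n; toℕ-fromℕ; toℕ-fromℕ<; <⇒≢; ≤̄⇒inject₁<)
  renaming (≤-refl to ≤ᶠ-refl)
open import Data.Maybe using (Maybe; just; nothing)
import Data.Maybe as M
open import Data.Product using (Σ-syntax; _×_; _,_; proj₁)
open import Data.Sum using (_⊎_; inj₁; inj₂)
open import Data.Unit using (tt)
open import Data.Bool using (if_then_else_)
open import Relation.Nullary using (¬_; does; yes; no; contradiction)
open import Relation.Nullary.Decidable using (dec-true; dec-false)
open import Relation.Binary.PropositionalEquality
  using (_≡_; _≢_; refl; sym; trans; cong; cong₂; subst)
open import Function.Bundles using (_⇔_; mk⇔)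
open import Function.Base using (_∘′_)

∸-excess-deficit : ∀ a c → a ∸ (a ∸ c) + (c ∸ a) ≡ c
∸-excess-deficit a c with ≤-total a c
... | inj₁ a≤c = trans (cong (λ k → a ∸ k + (c ∸ a)) (m≤n⇒m∸n≡0 a≤c)) (m+[n∸m]≡n a≤c)
... | inj₂ c≤a = trans (cong₂ _+_ (m∸[m∸n]≡n c≤a) (m≤n⇒m∸n≡0 c≤a)) (+-identityʳ c)

map≡nothing⁻¹ : ∀ {X Y : Set} (g : X → Y) (mx : Maybe X) → M.map g mx ≡ nothing → mx ≡ nothing
map≡nothing⁻¹ g nothing _ = refl
map≡nothing⁻¹ g (just x) ()

module Moves {b : ℕ} where

  _⊖_ : Fin (suc b) → Fin (suc b) → Fin (suc b)
  x ⊖ y = fromℕ< (≤-<-trans (m∸n≤m (toℕ x) (toℕ y)) (toℕ<n x))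

  toℕ-⊖ : ∀ x y → toℕ (x ⊖ y) ≡ toℕ x ∸ toℕ y
  toℕ-⊖ x y = toℕ-fromℕ< _

  -- The event (x ⊖ y, y ⊖ x) consumes the excess of x over y and
  -- produces the deficit; it leads from x to y.
  transfer : Fin (suc b) → Fin (suc b) → Ev b
  transfer x y = pair (x ⊖ y) (y ⊖ x)

  transfer-step : ∀ x y → Step b x (transfer x y) y
  transfer-step x y =
      subst (_≤ toℕ x) (sym (toℕ-⊖ x y)) (m∸n≤m (toℕ x) (toℕ y))
    , sym (trans (cong₂ (λ k l → toℕ x ∸ k + l) (toℕ-⊖ x y) (toℕ-⊖ y x))
                 (∸-excess-deficit (toℕ x) (toℕ y)))

  transfer-blocked : ∀ x y z → toℕ z < toℕ x ∸ toℕ y → ¬ OccursT b z (transfer x y)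
  transfer-blocked x y z z<x∸y (_ , x⊖y≤z , _) =
    <⇒≱ z<x∸y (subst (_≤ toℕ z) (toℕ-⊖ x y) x⊖y≤z)

  ⊖≡0⇒≤ : ∀ x y → x ⊖ y ≡ F.zero → toℕ x ≤ toℕ y
  ⊖≡0⇒≤ x y x⊖y≡0 = m∸n≡0⇒m≤n (trans (sym (toℕ-⊖ x y)) (cong toℕ x⊖y≡0))

  ≤⇒⊖≡0 : ∀ x y → toℕ x ≤ toℕ y → x ⊖ y ≡ F.zero
  ≤⇒⊖≡0 x y x≤y = toℕ-injective (trans (toℕ-⊖ x y) (m≤n⇒m∸n≡0 x≤y))

  -- At least one component of a transfer is 0 (it is allowed in τ₁, τ₃) …
  transfer-pure : ∀ x y → (x ⊖ y ≡ F.zero) ⊎ (y ⊖ x ≡ F.zero)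
  transfer-pure x y with ≤-total (toℕ x) (toℕ y)
  ... | inj₁ x≤y = inj₁ (≤⇒⊖≡0 x y x≤y)
  ... | inj₂ y≤x = inj₂ (≤⇒⊖≡0 y x y≤x)

  -- … and both are 0 only if x = y (so it is allowed in τ₂, τ₃ when x ≢ y).
  transfer-nontrivial : ∀ x y → x ≢ y → ¬ ((x ⊖ y ≡ F.zero) × (y ⊖ x ≡ F.zero))
  transfer-nontrivial x y x≢y (x⊖y≡0 , y⊖x≡0) =
    x≢y (toℕ-injective (≤-antisym (⊖≡0⇒≤ x y x⊖y≡0) (⊖≡0⇒≤ y x y⊖x≡0)))

  transfer-allowed : ∀ t x y → x ≢ y → Allowed t b (transfer x y)
  transfer-allowed τ0 x y x≢y = tt
  transfer-allowed τ1 x y x≢y = transfer-pure x y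
  transfer-allowed τ2 x y x≢y = transfer-nontrivial x y x≢y
  transfer-allowed τ3 x y x≢y = transfer-pure x y , transfer-nontrivial x y x≢y

  pair-zero-step : ∀ x → Step b x (pair F.zero F.zero) x
  pair-zero-step x = z≤n , sym (+-identityʳ (toℕ x))

  grp-zero-step : ∀ x → Step b x (grp F.zero) x
  grp-zero-step x = sym (trans (cong (_% suc b) (+-identityʳ (toℕ x))) (m<n⇒m%n≡m (toℕ<n x)))

open Moves

idEvent : (t : NetType) (b : ℕ) → TEv t b
idEvent τ0 b = pair F.zero F.zero , tt
idEvent τ1 b = pair F.zero F.zero , inj₁ refl
idEvent τ2 b = grp F.zero , tt
idEvent τ3 b = grp F.zero , tt

idEvent-step : ∀ t b x → Step b x (proj₁ (idEvent t b)) x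
idEvent-step τ0 b x = pair-zero-step x
idEvent-step τ1 b x = pair-zero-step x
idEvent-step τ2 b x = grp-zero-step x
idEvent-step τ3 b x = grp-zero-step x

move : (t : NetType) (b : ℕ) → Fin (suc b) → Fin (suc b) → TEv t b
move t b x y with x ≟ y
... | yes _ = idEvent t b
... | no x≢y = transfer x y , transfer-allowed t x y x≢y

move-step : ∀ t b x y → Step b x (proj₁ (move t b x y)) y
move-step t b x y with x ≟ y
... | yes refl = idEvent-step t b x
... | no _ = transfer-step x y

move-blocked : ∀ t b x y z → toℕ z < toℕ x ∸ toℕ y → ¬ OccursT b z (proj₁ (move t b x y))
move-blocked t b x y z z<x∸y with x ≟ y
... | yes refl = contradiction (subst (toℕ z <_) (n∸n≡0 (toℕ x)) z<x∸y) n≮0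
... | no _ = transfer-blocked x y z z<x∸y

admissible⇒1≤b : ∀ t b → Admissible t b → 1 ≤ b
admissible⇒1≤b τ0 b 1≤b = 1≤b
admissible⇒1≤b τ1 b 1≤b = 1≤b
admissible⇒1≤b τ2 b 2≤b = ≤-trans (s≤s z≤n) 2≤b
admissible⇒1≤b τ3 b 2≤b = ≤-trans (s≤s z≤n) 2≤b
module Joining (t : NetType) (b : ℕ) (adm : Admissible t b) {n m : ℕ} (A : Fin (suc n) → TS m) where

  top : Fin (suc b)
  top = fromℕ b

  0<top : 0 < toℕ top
  0<top = subst (0 <_) (sym (toℕ-fromℕ b)) (admissible⇒1≤b t b adm)

  top≢0 : top ≢ F.zero
  top≢0 top≡0 = <-irrefl (sym (cong toℕ top≡0)) 0<top

  -- The move from b to 0 cannot occur at 0: the blocking step of all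
  -- separations involving the connecting events wⱼ and yᵢ.
  down-blocked : ∀ {x y z} → z ≡ F.zero → x ≡ top → y ≡ F.zero →
                 ¬ OccursT b z (proj₁ (move t b x y))
  down-blocked refl refl refl = move-blocked t b top F.zero F.zero 0<top

  spike : Fin (suc n) → Fin (suc n) → Fin (suc b)
  spike k q = if does (q ≟ k) then top else F.zero

  spike-at : ∀ k → spike k k ≡ top
  spike-at k = cong (λ d → if d then top else F.zero) (dec-true (k ≟ k) refl)

  spike-off : ∀ k q → q ≢ k → spike k q ≡ F.zero
  spike-off k q q≢k = cong (λ d → if d then top else F.zero) (dec-false (q ≟ k) q≢k)

  spike-separates : ∀ k q → q ≢ k → spike k k ≢ spike k q
  spike-separates k q q≢k eq = top≢0 (trans (sym (spike-at k)) (trans eq (spike-off k q q≢k)))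

  inject₁≢suc : ∀ (j : Fin n) → F.suc j ≢ inject₁ j
  inject₁≢suc j = <⇒≢ (≤̄⇒inject₁< ≤ᶠ-refl) ∘′ sym

  flat : (Fin (suc n) → Fin (suc b)) → URegion A t b
  flat h = record { usup = λ x → h (proj₁ x) ; usig = λ _ → idEvent t b
                  ; uvalid = λ i _ _ _ _ → idEvent-step t b (h i) }

  zeroRegion : URegion A t b
  zeroRegion = flat (λ _ → F.zero)

  extend : URegion A t b → (Fin (suc n) → Fin (suc b)) → Region t b (Jδ A)
  extend R f = record { sup = sp ; sig = sg ; valid = vl }
    where
      sp : JS A → Fin (suc b)
      sp (inj₁ x) = usup R x
      sp (inj₂ q) = f q
      sg : JE A → TEv t b
      sg (inj₁ e) = usig R e
      sg (inj₂ (inj₁ j)) = move t b (f (inject₁ j)) (f (F.suc j))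
      sg (inj₂ (inj₂ i)) = move t b (f i) (usup R (i , s₀ (A i)))
      vl : ∀ s e s' → Jδ A s e ≡ just s' → Step b (sp s) (proj₁ (sg e)) (sp s')
      vl (inj₁ (i , s)) (inj₁ e) s' eq with δ (A i) s e in occ
      vl (inj₁ (i , s)) (inj₁ e) _ refl | just s' = uvalid R i s e s' occ
      vl (inj₁ (i , s)) (inj₁ e) _ () | nothing
      vl (inj₁ _) (inj₂ _) _ ()
      vl (inj₂ q) (inj₁ e) _ ()
      vl (inj₂ q) (inj₂ (inj₁ j)) s' eq with q ≟ inject₁ j
      vl (inj₂ q) (inj₂ (inj₁ j)) _ refl | yes refl = move-step t b _ _
      vl (inj₂ q) (inj₂ (inj₁ j)) _ () | no _
      vl (inj₂ q) (inj₂ (inj₂ i)) s' eq with q ≟ i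
      vl (inj₂ q) (inj₂ (inj₂ i)) _ refl | yes refl = move-step t b _ _
      vl (inj₂ q) (inj₂ (inj₂ i)) _ () | no _

  restrict : Region t b (Jδ A) → URegion A t b
  restrict R = record
    { usup = λ x → sup R (inj₁ x)
    ; usig = λ e → sig R (inj₁ e)
    ; uvalid = λ i s e s' occ →
        valid R (inj₁ (i , s)) (inj₁ e) (inj₁ (i , s')) (cong (M.map (λ s'' → inj₁ (i , s''))) occ) }

  essp← : ESSP t b (Jδ A) → UESSP A t b
  essp← essp e (i , s) blocked
    with R , ¬occ ← essp (inj₁ e) (inj₁ (i , s)) (cong (M.map (λ s' → inj₁ (i , s'))) blocked)
    = restrict R , ¬occ

  ssp← : SSP t b (Jδ A) → USSP A t b
  ssp← ssp i s s' s≢s'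
    with R , sep ← ssp (inj₁ (i , s)) (inj₁ (i , s')) (λ { refl → s≢s' refl })
    = restrict R , sep

  -- Events of U are blocked at a state of Q by extending a region of U
  -- blocking them somewhere, constant on Q; the connecting events are
  -- blocked by a spike at their source.
  essp→ : (∀ e → Σ[ x ∈ SU A ] NotOccU A e x) → UESSP A t b → ESSP t b (Jδ A)
  essp→ _ uessp (inj₁ e) (inj₁ (i , s)) blocked
    with R , ¬occ ← uessp e (i , s) (map≡nothing⁻¹ _ _ blocked)
    = extend R (λ _ → F.zero) , ¬occ
  essp→ somewhere uessp (inj₁ e) (inj₂ q) _
    with x , blocked ← somewhere e
    with R , ¬occ ← uessp e x blocked
    = extend R (λ _ → usup R x) , ¬occ
  essp→ _ _ (inj₂ (inj₁ j)) (inj₁ x) _ =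
    extend zeroRegion (spike (inject₁ j))
    , down-blocked refl (spike-at (inject₁ j)) (spike-off (inject₁ j) (F.suc j) (inject₁≢suc j))
  essp→ _ _ (inj₂ (inj₁ j)) (inj₂ q) blocked with q ≟ inject₁ j
  ... | no q≢qⱼ = extend zeroRegion (spike (inject₁ j))
                  , down-blocked (spike-off (inject₁ j) q q≢qⱼ) (spike-at (inject₁ j))
                      (spike-off (inject₁ j) (F.suc j) (inject₁≢suc j))
  essp→ _ _ (inj₂ (inj₁ j)) (inj₂ q) () | yes _
  essp→ _ _ (inj₂ (inj₂ i)) (inj₁ x) _ =
    extend zeroRegion (spike i) , down-blocked refl (spike-at i) refl
  essp→ _ _ (inj₂ (inj₂ i)) (inj₂ q) blocked with q ≟ i
  ... | no q≢qᵢ = extend zeroRegion (spike i) , down-blocked (spike-off i q q≢qᵢ) (spike-at i) refl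
  essp→ _ _ (inj₂ (inj₂ i)) (inj₂ q) () | yes _

  -- States of one component are separated by U; different components by
  -- a flat spike; U from Q by the support b on Q; states of Q by a spike.
  ssp→ : USSP A t b → SSP t b (Jδ A)
  ssp→ ussp (inj₁ (i , s)) (inj₁ (j , s')) x≢x' with i ≟ j
  ... | no i≢j = extend (flat (spike i)) (λ _ → F.zero) , spike-separates i j (i≢j ∘′ sym)
  ... | yes refl with R , sep ← ussp i s s' (λ { refl → x≢x' refl }) = extend R (λ _ → F.zero) , sep
  ssp→ _ (inj₁ _) (inj₂ _) _ = extend zeroRegion (λ _ → top) , λ 0≡top → top≢0 (sym 0≡top)
  ssp→ _ (inj₂ _) (inj₁ _) _ = extend zeroRegion (λ _ → top) , top≢0
  ssp→ _ (inj₂ q) (inj₂ q') q≢q' =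
    extend zeroRegion (spike q) , spike-separates q q' (λ { refl → q≢q' refl })

lemma2 : (t : NetType) (b : ℕ) → Admissible t b →
    (n m : ℕ) (A : Fin (suc n) → TS m) →
    (∀ (e : Fin m) → Σ[ x ∈ SU A ] NotOccU A e x) →
    (UESSP A t b ⇔ ESSP t b (Jδ A)) × (USSP A t b ⇔ SSP t b (Jδ A))
lemma2 t b adm n m A somewhere-blocked =
  mk⇔ (essp→ somewhere-blocked) essp← , mk⇔ ssp→ ssp←
  where open Joining t b adm A
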